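{- For every $n \ge 7$, there is no $K_{1,3}$-induced-saturated graph on $n$ vertices whose degree sequence is $(6,4,\dots,4)$, i.e. with exactly one vertex of degree $6$ and all other $n-1$ vertices of degree $4$.
   Context: All graphs are finite and simple. For a graph $H$, a graph $G$ is $H$-induced-saturated if $G$ contains no induced subgraph isomorphic to $H$, but for every pair of distinct vertices $u,v$ of $G$, the graph obtained from $G$ by adding the edge $uv$ (if $uv\notin E(G)$) or deleting it (if $uv\in E(G)$) contains an induced subgraph isomorphic to $H$. -}

module Defs where

open import Data.Nat using (ℕ; _≥_)
open import Data.Bool using (Bool; true; false; not; if_then_else_)
open import Data.Fin using (Fin; _≟_)
open import Data.Fin.Properties using () 
open import Data.List using (List; length; filter)
open import Data.List using () renaming (allFin to allFinL)
open import Data.Product using (Σ; _×_; ∃; ∃-syntax)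
open import Relation.Binary.PropositionalEquality using (_≡_; _≢_)
open import Relation.Nullary using (¬_; Dec; yes; no; does)
open import Relation.Nullary.Decidable using (⌊_⌋)
open import Data.Bool.Properties using () renaming (_≟_ to _≟B_)

record Graph (n : ℕ) : Set where
  field
    adj   : Fin n → Fin n → Bool
    sym   : ∀ u v → adj u v ≡ adj v u
    irrefl : ∀ v → adj v v ≡ false
open Graph public

Adj : ∀ {n} → Graph n → Fin n → Fin n → Set
Adj G u v = adj G u v ≡ true

-- Toggle the pair {u,v} (u ≢ v): add the edge if absent, delete if present.
flipAdj : ∀ {n} → Graph n → Fin n → Fin n → Fin n → Fin n → Bool
flipAdj G u v x y =
  if (⌊ x ≟ u ⌋ Data.Bool.∧ ⌊ y ≟ v ⌋) Data.Bool.∨ (⌊ x ≟ v ⌋ Data.Bool.∧ ⌊ y ≟ u ⌋)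
  then not (adj G x y) else adj G x y

HasInducedClawRel : ∀ {n} → (Fin n → Fin n → Bool) → Set
HasInducedClawRel {n} A =
  Σ (Fin n) λ c → Σ (Fin n) λ a → Σ (Fin n) λ b → Σ (Fin n) λ d →
    (c ≢ a) × (c ≢ b) × (c ≢ d) × (a ≢ b) × (a ≢ d) × (b ≢ d) ×
    A c a ≡ true × A c b ≡ true × A c d ≡ true ×
    ¬ A a b ≡ true × ¬ A a d ≡ true × ¬ A b d ≡ true

HasInducedClaw : ∀ {n} → Graph n → Set
HasInducedClaw G = HasInducedClawRel (adj G)

ClawInducedSaturated : ∀ {n} → Graph n → Set
ClawInducedSaturated {n} G =
  ¬ HasInducedClaw G ×
  (∀ (u v : Fin n) → u ≢ v → HasInducedClawRel (flipAdj G u v))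

degree : ∀ {n} → Graph n → Fin n → ℕ
degree {n} G v = length (filter (λ w → adj G v w ≟B true) (allFinL n))

-- Let x be the vertex of degree 6.  Deleting an edge uv of a claw-free graph can
-- only create a claw with leaves u and v, i.e. a common neighbour c of u and v
-- with a neighbour d adjacent to neither.  If y ∈ N(x) had at most one common
-- neighbour with x, the (at least four) other neighbours of x would form a
-- clique by claw-freeness at x; but deleting xw for w in such a K₄ needs a
-- centre in the K₄, all of whose neighbours lie in N[x].  Using this with the
-- degree bound 4, the claws created by edge deletions force every
-- y ∈ N(x) to have N(y) = {x, a, b, o} with N(x) ∩ N(y) = {a, b} and a single
-- neighbour o outside N[x], adjacent to b but not to a.  Then N(x) is
-- triangle-free: in a triangle p a b the outer neighbour of a, which is adjacent
-- to p or to b, would equal that of p, which misses a.  Yet the three neighbours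
-- of x other than y, a and b form a triangle by claw-freeness at x.
module Submission where

open import Defs
open import Data.Nat using (ℕ; zero; suc; _+_; _≤_; _<_; _≥_; s≤s; z≤n)
open import Data.Nat.Properties using (≤-trans; ≤-reflexive; n≤1+n; <⇒≱; ≤⇒≯)
open import Data.Bool using (true; not; if_then_else_; _∧_; _∨_)
open import Data.Bool.Properties using (∧-comm; ∨-comm) renaming (_≟_ to _≟B_)
open import Data.Fin using (Fin; _≟_)
open import Data.List using (List; []; _∷_; _++_; length; filter) renaming (allFin to allFinL)
open import Data.List.Properties using (length-++; filter-notAll)
open import Data.List.Membership.Propositional using (_∈_; _∉_; find)
open import Data.List.Membership.Propositional.Properties using (∈-filter⁺; ∈-filter⁻; ∈-allFin; ∈-++⁺ˡ; ∈-++⁺ʳ)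
open import Data.List.Membership.DecPropositional using () renaming (_∈?_ to ∈?-with)
open import Data.List.Relation.Binary.Subset.Propositional using (_⊆_)
open import Data.List.Relation.Unary.Any using (here; there)
import Data.List.Relation.Unary.Any as Any
open import Data.List.Relation.Unary.All using (All; []; _∷_; all?)
import Data.List.Relation.Unary.All as All
open import Data.List.Relation.Unary.All.Properties using (¬Any⇒All¬; ¬All⇒Any¬)
open import Data.List.Relation.Unary.AllPairs using (AllPairs; []; _∷_)
import Data.List.Relation.Unary.AllPairs as AllPairs
open import Data.List.Relation.Unary.Unique.Propositional using (Unique)
open import Data.List.Relation.Unary.Unique.Propositional.Properties using (allFin⁺; filter⁺)
open import Data.Vec using (Vec; []; _∷_; toList)
open import Data.Vec.Properties using (length-toList)
open import Data.Product using (Σ; _×_; _,_; proj₁; proj₂; -,_; ∃-syntax; ∃₂)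
open import Data.Sum using (_⊎_; inj₁; inj₂; [_,_]′)
open import Data.Empty using (⊥; ⊥-elim)
open import Function using (_∘_)
open import Relation.Binary.Definitions using (DecidableEquality)
open import Relation.Binary.PropositionalEquality using (_≡_; _≢_; refl; trans; subst; cong; cong₂; ≢-sym)
  renaming (sym to ≡-sym)
open import Relation.Nullary using (¬_; Dec; yes; no; ¬?)
open import Relation.Nullary.Decidable using (⌊_⌋; decidable-stable)

Unique-⊆⇒length≤ : ∀ {a} {A : Set a} → DecidableEquality A → {xs ys : List A} →
                    Unique xs → xs ⊆ ys → length xs ≤ length ys
Unique-⊆⇒length≤ _≟_ {[]} _ _ = z≤n
Unique-⊆⇒length≤ _≟_ {x ∷ xs} {ys} (x∉xs ∷ uxs) xs⊆ys =
  ≤-trans (s≤s (Unique-⊆⇒length≤ _≟_ uxs xs⊆ys-x))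
          (filter-notAll (¬? ∘ (x ≟_)) ys (Any.map (λ x≡y x≢y → x≢y x≡y) (xs⊆ys (here refl))))
  where
  xs⊆ys-x : xs ⊆ filter (¬? ∘ (x ≟_)) ys
  xs⊆ys-x z∈xs = ∈-filter⁺ (¬? ∘ (x ≟_)) (xs⊆ys (there z∈xs)) (All.lookup x∉xs z∈xs)

module Adjacency {n : ℕ} (G : Graph n) where

  infix 4 _~_ _≁_

  _~_ : Fin n → Fin n → Set
  _~_ = Adj G

  _≁_ : Fin n → Fin n → Set
  u ≁ v = ¬ u ~ v

  ~-sym : ∀ {u v} → u ~ v → v ~ u
  ~-sym {u} {v} u~v = trans (sym G v u) u~v

  ≁-sym : ∀ {u v} → u ≁ v → v ≁ u
  ≁-sym u≁v = u≁v ∘ ~-sym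

  ~⇒≢ : ∀ {u v} → u ~ v → u ≢ v
  ~⇒≢ {u} u~u refl with trans (≡-sym u~u) (irrefl G u)
  ... | ()

  adjacent? : ∀ u v → Dec (u ~ v)
  adjacent? u v = adj G u v ≟B true

  Neighbours : Fin n → List (Fin n)
  Neighbours v = filter (adjacent? v) (allFinL n)

  ∈Neighbours⁺ : ∀ {v w} → v ~ w → w ∈ Neighbours v
  ∈Neighbours⁺ {v} {w} = ∈-filter⁺ (adjacent? v) (∈-allFin w)

  ∈Neighbours⁻ : ∀ {v w} → w ∈ Neighbours v → v ~ w
  ∈Neighbours⁻ {v} w∈N = proj₂ (∈-filter⁻ (adjacent? v) {xs = allFinL n} w∈N)

  Neighbours-Unique : ∀ v → Unique (Neighbours v)
  Neighbours-Unique v = filter⁺ (adjacent? v) (allFin⁺ n)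

  _∈?_ : ∀ (w : Fin n) L → Dec (w ∈ L)
  _∈?_ = ∈?-with _≟_

  degree-≥ : ∀ {v L} → Unique L → All (v ~_) L → length L ≤ degree G v
  degree-≥ uL v~L = Unique-⊆⇒length≤ _≟_ uL (∈Neighbours⁺ ∘ All.lookup v~L)

  neighbours-⊆ : ∀ {v w L} → Unique L → All (v ~_) L → degree G v ≤ length L → v ~ w → w ∈ L
  neighbours-⊆ {v} {w} {L} uL v~L deg≤ v~w with w ∈? L
  ... | yes w∈L = w∈L
  ... | no  w∉L = ⊥-elim (≤⇒≯ deg≤ (degree-≥ (¬Any⇒All¬ L w∉L ∷ uL) (v~w ∷ v~L)))

  fresh-neighbour : ∀ {v} L → length L < degree G v → ∃[ w ] v ~ w × w ∉ L
  fresh-neighbour {v} L |L|<deg with all? (_∈? L) (Neighbours v)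
  ... | yes N⊆L = ⊥-elim (<⇒≱ |L|<deg (Unique-⊆⇒length≤ _≟_ (Neighbours-Unique v) (All.lookup N⊆L)))
  ... | no  N⊈L with find (¬All⇒Any¬ (_∈? L) (Neighbours v) N⊈L)
  ...   | w , w∈N , w∉L = w , ∈Neighbours⁻ w∈N , w∉L

  fresh-neighbours : ∀ k {v} L → k + length L ≤ degree G v →
                     Σ (Vec (Fin n) k) λ ws → Unique (toList ws) × All (λ w → v ~ w × w ∉ L) (toList ws)
  fresh-neighbours zero    L _     = [] , [] , []
  fresh-neighbours (suc k) L bound with fresh-neighbours k L (≤-trans (n≤1+n _) bound)
  ... | ws , uws , hs with fresh-neighbour (toList ws ++ L) |ws++L|<deg
    where
    |ws++L|<deg : length (toList ws ++ L) < _
    |ws++L|<deg = subst (λ m → suc m ≤ _)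
                        (≡-sym (trans (length-++ (toList ws)) (cong (_+ length L) (length-toList ws))))
                        bound
  ... | w , v~w , w∉ws++L =
    w ∷ ws , ¬Any⇒All¬ _ (w∉ws++L ∘ ∈-++⁺ˡ) ∷ uws , (v~w , w∉ws++L ∘ ∈-++⁺ʳ _) ∷ hs

module Claws {n : ℕ} (G : Graph n) where
  open Adjacency G

  ClawFree : Set
  ClawFree = ¬ HasInducedClaw G

  claw-free⇒adjacent : ClawFree → ∀ {c y p q} → c ~ y → c ~ p → c ~ q →
                       y ≢ p → y ≢ q → p ≢ q → y ≁ p → y ≁ q → p ~ q
  claw-free⇒adjacent cf {c} {y} {p} {q} c~y c~p c~q y≢p y≢q p≢q y≁p y≁q =
    decidable-stable (adjacent? p q) λ p≁q →
      cf (c , y , p , q , ~⇒≢ c~y , ~⇒≢ c~p , ~⇒≢ c~q , y≢p , y≢q , p≢q , c~y , c~p , c~q , y≁p , y≁q , p≁q)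

  clique-of-non-neighbours : ClawFree → ∀ {c y ws} → c ~ y → Unique ws →
                             All (λ w → c ~ w × y ≢ w × y ≁ w) ws → AllPairs _~_ ws
  clique-of-non-neighbours cf c~y [] [] = []
  clique-of-non-neighbours cf c~y (w≢ws ∷ uws) ((c~w , y≢w , y≁w) ∷ hs) =
    All.zipWith (λ (w≢z , c~z , y≢z , y≁z) → claw-free⇒adjacent cf c~y c~w c~z y≢w y≢z w≢z y≁w y≁z) (w≢ws , hs)
    ∷ clique-of-non-neighbours cf c~y uws hs

  SamePair : Fin n → Fin n → Fin n → Fin n → Set
  SamePair u v p q = (p ≡ u × q ≡ v) ⊎ (p ≡ v × q ≡ u)

  module _ {u v : Fin n} where

    flipAdj-sym : ∀ p q → flipAdj G u v p q ≡ flipAdj G u v q p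
    flipAdj-sym p q =
      cong₂ (λ b e → if b then not e else e)
            (trans (∨-comm (⌊ p ≟ u ⌋ ∧ ⌊ q ≟ v ⌋) _)
                   (cong₂ _∨_ (∧-comm ⌊ p ≟ v ⌋ ⌊ q ≟ u ⌋) (∧-comm ⌊ p ≟ u ⌋ ⌊ q ≟ v ⌋)))
            (sym G p q)

    flipAdj-true⇒ : u ~ v → ∀ {p q} → flipAdj G u v p q ≡ true → p ~ q
    flipAdj-true⇒ u~v {p} {q} F with p ≟ u | q ≟ v | p ≟ v | q ≟ u
    ... | yes refl | yes refl | _        | _        = u~v
    ... | _        | _        | yes refl | yes refl = ~-sym u~v
    ... | no _     | _        | no _     | _        = F
    ... | no _     | _        | yes _    | no _     = F
    ... | yes _    | no _     | no _     | _        = F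
    ... | yes _    | no _     | yes _    | no _     = F

    flipAdj-false⇒ : ∀ {p q} → ¬ flipAdj G u v p q ≡ true → SamePair u v p q ⊎ p ≁ q
    flipAdj-false⇒ {p} {q} ¬F with p ≟ u | q ≟ v | p ≟ v | q ≟ u
    ... | yes p≡u | yes q≡v | _       | _       = inj₁ (inj₁ (p≡u , q≡v))
    ... | _       | _       | yes p≡v | yes q≡u = inj₁ (inj₂ (p≡v , q≡u))
    ... | no _    | _       | no _    | _       = inj₂ ¬F
    ... | no _    | _       | yes _   | no _    = inj₂ ¬F
    ... | yes _   | no _    | no _    | _       = inj₂ ¬F
    ... | yes _   | no _    | yes _   | no _    = inj₂ ¬F

    flipAdj-false-away : ∀ {p r} → ¬ flipAdj G u v p r ≡ true → r ≢ u → r ≢ v → r ≁ p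
    flipAdj-false-away ¬F r≢u r≢v with flipAdj-false⇒ ¬F
    ... | inj₁ (inj₁ (_ , r≡v)) = ⊥-elim (r≢v r≡v)
    ... | inj₁ (inj₂ (_ , r≡u)) = ⊥-elim (r≢u r≡u)
    ... | inj₂ p≁r              = ≁-sym p≁r

    flipAdj-false-sym : ∀ {p q} → ¬ flipAdj G u v p q ≡ true → ¬ flipAdj G u v q p ≡ true
    flipAdj-false-sym {p} {q} ¬F = ¬F ∘ trans (flipAdj-sym p q)

  record DeletionClaw (u v c d : Fin n) : Set where
    constructor deletionClaw
    field
      c~u : c ~ u
      c~v : c ~ v
      c~d : c ~ d
      d≁u : d ≁ u
      d≁v : d ≁ v

  deletionClaw-from-leaves : ∀ {u v c p q r} → c ~ p → c ~ q → c ~ r → p ≢ r → q ≢ r →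
                             ¬ flipAdj G u v p r ≡ true → ¬ flipAdj G u v q r ≡ true → SamePair u v p q →
                             DeletionClaw u v c r
  deletionClaw-from-leaves c~p c~q c~r p≢r q≢r p≁r q≁r (inj₁ (refl , refl)) =
    deletionClaw c~p c~q c~r (flipAdj-false-away p≁r (≢-sym p≢r) (≢-sym q≢r))
                             (flipAdj-false-away q≁r (≢-sym p≢r) (≢-sym q≢r))
  deletionClaw-from-leaves c~p c~q c~r p≢r q≢r p≁r q≁r (inj₂ (refl , refl)) =
    deletionClaw c~q c~p c~r (flipAdj-false-away q≁r (≢-sym q≢r) (≢-sym p≢r))
                             (flipAdj-false-away p≁r (≢-sym q≢r) (≢-sym p≢r))

  -- Deleting uv only removes an adjacency, so the new claw has u and v as two of its leaves.
  deletion-claw : ClawFree → ∀ {u v} → u ~ v → HasInducedClawRel (flipAdj G u v) → ∃₂ (DeletionClaw u v)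
  deletion-claw cf u~v (c , a , b , d , _ , _ , _ , a≢b , a≢d , b≢d , Fca , Fcb , Fcd , a≁b , a≁d , b≁d)
    with flipAdj-true⇒ u~v Fca | flipAdj-true⇒ u~v Fcb | flipAdj-true⇒ u~v Fcd
       | flipAdj-false⇒ a≁b | flipAdj-false⇒ a≁d | flipAdj-false⇒ b≁d
  ... | c~a | c~b | c~d | inj₁ ab | _ | _ =
    c , d , deletionClaw-from-leaves c~a c~b c~d a≢d b≢d a≁d b≁d ab
  ... | c~a | c~b | c~d | _ | inj₁ ad | _ =
    c , b , deletionClaw-from-leaves c~a c~d c~b a≢b (≢-sym b≢d) a≁b (flipAdj-false-sym b≁d) ad
  ... | c~a | c~b | c~d | _ | _ | inj₁ bd =
    c , a , deletionClaw-from-leaves c~b c~d c~a (≢-sym a≢b) (≢-sym a≢d) (flipAdj-false-sym a≁b) (flipAdj-false-sym a≁d) bd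
  ... | c~a | c~b | c~d | inj₂ a≁ᴳb | inj₂ a≁ᴳd | inj₂ b≁ᴳd =
    ⊥-elim (cf (c , a , b , d , ~⇒≢ c~a , ~⇒≢ c~b , ~⇒≢ c~d , a≢b , a≢d , b≢d , c~a , c~b , c~d , a≁ᴳb , a≁ᴳd , b≁ᴳd))

module DegreeSixVertex {n : ℕ} {G : Graph n} (claw-free : Claws.ClawFree G)
                       (deletion : ∀ {u v} → Adj G u v → ∃₂ (Claws.DeletionClaw G u v))
                       (x : Fin n) (deg-x : degree G x ≡ 6) (deg-N : ∀ w → w ≢ x → degree G w ≡ 4) where
  open Adjacency G
  open Claws G

  infix 4 _∈N[x] _∉N[x]

  _∈N[x] : Fin n → Set
  z ∈N[x] = z ≡ x ⊎ x ~ z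

  _∉N[x] : Fin n → Set
  z ∉N[x] = ¬ z ∈N[x]

  deletion-leaf-∉N[x] : ∀ {w c d} → x ~ w → DeletionClaw x w c d → d ∉N[x]
  deletion-leaf-∉N[x] x~w (deletionClaw _ _ _ d≁x d≁w) (inj₁ refl) = d≁w x~w
  deletion-leaf-∉N[x] x~w (deletionClaw _ _ _ d≁x d≁w) (inj₂ x~d) = d≁x (~-sym x~d)

  outside-common-neighbours : ∀ {y L} → y ∈ L → (∀ {z} → x ~ z → y ~ z → z ∈ L) →
                              ∀ {w} → x ~ w × w ∉ L → x ~ w × y ≢ w × y ≁ w
  outside-common-neighbours y∈L common (x~w , w∉L) = x~w , (λ { refl → w∉L y∈L }) , w∉L ∘ common x~w

  neighbours-of-neighbour : ∀ {v z L} → x ~ v → Unique L → All (v ~_) L → length L ≡ 4 → v ~ z → z ∈ L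
  neighbours-of-neighbour x~v uL v~L |L|≡4 =
    neighbours-⊆ uL v~L (≤-reflexive (trans (deg-N _ (≢-sym (~⇒≢ x~v))) (≡-sym |L|≡4)))

  neighbours-∈N[x] : ∀ {p z L} → x ~ p → AllPairs _~_ L → All (λ q → x ~ q × p ~ q) L → length L ≡ 3 →
                     p ~ z → z ∈N[x]
  neighbours-∈N[x] x~p clique hL |L|≡3 p~z
    with neighbours-of-neighbour x~p (All.map (~⇒≢ ∘ proj₁) hL ∷ AllPairs.map ~⇒≢ clique)
                                     (~-sym x~p ∷ All.map proj₂ hL) (cong suc |L|≡3) p~z
  ... | here z≡x  = inj₁ z≡x
  ... | there z∈L = inj₂ (proj₁ (All.lookup hL z∈L))

  -- The centre of the claw created by deleting xw₁ lies in the K₄, whose vertices have no neighbours outside N[x].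
  no-K₄ : (ws : Vec (Fin n) 4) → All (x ~_) (toList ws) → AllPairs _~_ (toList ws) → ⊥
  no-K₄ (w₁ ∷ w₂ ∷ w₃ ∷ w₄ ∷ []) (x~w₁ ∷ x~w₂ ∷ x~w₃ ∷ x~w₄ ∷ [])
        ((w₁~w₂ ∷ w₁~w₃ ∷ w₁~w₄ ∷ []) ∷ K₂₃₄@((w₂~w₃ ∷ w₂~w₄ ∷ []) ∷ (w₃~w₄ ∷ []) ∷ [] ∷ []))
    with deletion x~w₁
  ... | c , d , D@(deletionClaw c~x c~w₁ c~d _ _)
    with neighbours-of-neighbour x~w₁ (AllPairs.map ~⇒≢ ((x~w₂ ∷ x~w₃ ∷ x~w₄ ∷ []) ∷ K₂₃₄))
                                      (~-sym x~w₁ ∷ w₁~w₂ ∷ w₁~w₃ ∷ w₁~w₄ ∷ []) refl (~-sym c~w₁)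
  ... | here refl = ~⇒≢ c~x refl
  ... | there (here refl) = deletion-leaf-∉N[x] x~w₁ D
    (neighbours-∈N[x] x~w₂ ((w₁~w₃ ∷ w₁~w₄ ∷ []) ∷ (w₃~w₄ ∷ []) ∷ [] ∷ [])
                      ((x~w₁ , ~-sym w₁~w₂) ∷ (x~w₃ , w₂~w₃) ∷ (x~w₄ , w₂~w₄) ∷ []) refl c~d)
  ... | there (there (here refl)) = deletion-leaf-∉N[x] x~w₁ D
    (neighbours-∈N[x] x~w₃ ((w₁~w₂ ∷ w₁~w₄ ∷ []) ∷ (w₂~w₄ ∷ []) ∷ [] ∷ [])
                      ((x~w₁ , ~-sym w₁~w₃) ∷ (x~w₂ , ~-sym w₂~w₃) ∷ (x~w₄ , w₃~w₄) ∷ []) refl c~d)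
  ... | there (there (there (here refl))) = deletion-leaf-∉N[x] x~w₁ D
    (neighbours-∈N[x] x~w₄ ((w₁~w₂ ∷ w₁~w₃ ∷ []) ∷ (w₂~w₃ ∷ []) ∷ [] ∷ [])
                      ((x~w₁ , ~-sym w₁~w₄) ∷ (x~w₂ , ~-sym w₂~w₄) ∷ (x~w₃ , ~-sym w₃~w₄) ∷ []) refl c~d)

  common-neighbours-⊈-singleton : ∀ {y c} → x ~ y → ¬ (∀ {z} → x ~ z → y ~ z → z ≡ c)
  common-neighbours-⊈-singleton {y} {c} x~y unique =
    let ws , uws , hs = fresh-neighbours 4 (y ∷ c ∷ []) (≤-reflexive (≡-sym deg-x))
    in no-K₄ ws (All.map proj₁ hs)
             (clique-of-non-neighbours claw-free x~y uws
               (All.map (outside-common-neighbours (here refl) (λ x~z y~z → there (here (unique x~z y~z)))) hs))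

  two-neighbours-∉N[x] : ∀ {u c d d′} → x ~ u → x ~ c → u ~ c → u ~ d → u ~ d′ → d ≢ d′ →
                         d ∉N[x] → d′ ∉N[x] → ⊥
  two-neighbours-∉N[x] {u} {c} {d} {d′} x~u x~c u~c u~d u~d′ d≢d′ d∉ d′∉ =
    common-neighbours-⊈-singleton x~u only-c
    where
    c≢ : ∀ {z} → z ∉N[x] → c ≢ z
    c≢ z∉ refl = z∉ (inj₂ x~c)
    N[u] : ∀ {z} → u ~ z → z ∈ x ∷ c ∷ d ∷ d′ ∷ []
    N[u] = neighbours-of-neighbour x~u
             ((~⇒≢ x~c ∷ ≢-sym (d∉ ∘ inj₁) ∷ ≢-sym (d′∉ ∘ inj₁) ∷ []) ∷ (c≢ d∉ ∷ c≢ d′∉ ∷ []) ∷ (d≢d′ ∷ []) ∷ [] ∷ [])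
             (~-sym x~u ∷ u~c ∷ u~d ∷ u~d′ ∷ []) refl
    only-c : ∀ {z} → x ~ z → u ~ z → z ≡ c
    only-c x~z u~z with N[u] u~z
    ... | here refl                         = ⊥-elim (~⇒≢ x~z refl)
    ... | there (here z≡c)                  = z≡c
    ... | there (there (here refl))         = ⊥-elim (d∉ (inj₂ x~z))
    ... | there (there (there (here refl))) = ⊥-elim (d′∉ (inj₂ x~z))

  record Neighbourhood (y a b o : Fin n) : Set where
    field
      x~y : x ~ y
      x~a : x ~ a
      x~b : x ~ b
      y~a : y ~ a
      y~b : y ~ b
      y~o : y ~ o
      o~b : o ~ b
      o≁a : o ≁ a
      o∉N[x] : o ∉N[x]
      neighbours : ∀ {z} → y ~ z → z ∈ x ∷ a ∷ b ∷ o ∷ []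

  module N = Neighbourhood

  common-neighbour : ∀ {y a b o z} → Neighbourhood y a b o → x ~ z → y ~ z → z ≡ a ⊎ z ≡ b
  common-neighbour Ny x~z y~z with N.neighbours Ny y~z
  ... | here refl                         = ⊥-elim (~⇒≢ x~z refl)
  ... | there (here z≡a)                  = inj₁ z≡a
  ... | there (there (here z≡b))          = inj₂ z≡b
  ... | there (there (there (here refl))) = ⊥-elim (N.o∉N[x] Ny (inj₂ x~z))

  private-neighbour : ∀ {y a b o z} → Neighbourhood y a b o → y ~ z → z ∉N[x] → z ≡ o
  private-neighbour Ny y~z z∉ with N.neighbours Ny y~z
  ... | here z≡x                          = ⊥-elim (z∉ (inj₁ z≡x))
  ... | there (here refl)                 = ⊥-elim (z∉ (inj₂ (N.x~a Ny)))
  ... | there (there (here refl))         = ⊥-elim (z∉ (inj₂ (N.x~b Ny)))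
  ... | there (there (there (here z≡o))) = z≡o

  neighbourhood-from-leaf : ∀ {c y d} → x ~ c → x ~ y → c ~ y → c ~ d → y ≁ d → d ∉N[x] →
                            ∃[ e ] Neighbourhood c y e d
  neighbourhood-from-leaf {c} {y} {d} x~c x~y c~y c~d y≁d d∉ with deletion c~d
  ... | e , _ , deletionClaw e~c e~d _ _ _ = e , record
    { x~y = x~c ; x~a = x~y ; x~b = x~e ; y~a = c~y ; y~b = ~-sym e~c ; y~o = c~d
    ; o~b = ~-sym e~d ; o≁a = ≁-sym y≁d ; o∉N[x] = d∉ ; neighbours = N[c] }
    where
    e∉N[x] : x ≁ e → e ∉N[x]
    e∉N[x] x≁e (inj₁ e≡x) = d∉ (inj₂ (subst (_~ d) e≡x e~d))
    e∉N[x] x≁e (inj₂ x~e) = x≁e x~e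
    x~e : x ~ e
    x~e = decidable-stable (adjacent? x e) λ x≁e →
      two-neighbours-∉N[x] x~c x~y c~y (~-sym e~c) c~d (~⇒≢ e~d) (e∉N[x] x≁e) d∉
    y≢e : y ≢ e
    y≢e y≡e = y≁d (subst (_~ d) (≡-sym y≡e) e~d)
    y≢d : y ≢ d
    y≢d y≡d = d∉ (inj₂ (subst (x ~_) y≡d x~y))
    N[c] : ∀ {z} → c ~ z → z ∈ x ∷ y ∷ e ∷ d ∷ []
    N[c] = neighbours-of-neighbour x~c
             ((~⇒≢ x~y ∷ ~⇒≢ x~e ∷ ≢-sym (d∉ ∘ inj₁) ∷ []) ∷ (y≢e ∷ y≢d ∷ []) ∷ (~⇒≢ e~d ∷ []) ∷ [] ∷ [])
             (~-sym x~c ∷ c~y ∷ ~-sym e~c ∷ c~d ∷ []) refl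

  neighbourhood-via-centre : ∀ {y c e d c′ d′} → x ~ y → Neighbourhood c y e d → DeletionClaw x c c′ d′ →
                             c′ ∈ x ∷ y ∷ e ∷ d ∷ [] → ∃[ a ] ∃[ b ] ∃[ o ] Neighbourhood y a b o
  neighbourhood-via-centre x~y Nc (deletionClaw c′~x _ _ _ _) (here refl) = ⊥-elim (~⇒≢ c′~x refl)
  neighbourhood-via-centre x~y Nc D′@(deletionClaw _ c′~c c′~d′ _ d′≁c) (there (here refl)) =
    let e′ , Ny = neighbourhood-from-leaf x~y (N.x~y Nc) c′~c c′~d′ (≁-sym d′≁c) (deletion-leaf-∉N[x] (N.x~y Nc) D′)
    in -, e′ , -, Ny
  neighbourhood-via-centre x~y Nc D′@(deletionClaw _ c′~c c′~d′ _ d′≁c) (there (there (here refl))) =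
    ⊥-elim (two-neighbours-∉N[x] (N.x~b Nc) (N.x~y Nc) c′~c (~-sym (N.o~b Nc)) c′~d′
                                  (λ { refl → d′≁c (~-sym (N.y~o Nc)) })
                                  (N.o∉N[x] Nc) (deletion-leaf-∉N[x] (N.x~y Nc) D′))
  neighbourhood-via-centre x~y Nc (deletionClaw c′~x _ _ _ _) (there (there (there (here refl)))) =
    ⊥-elim (N.o∉N[x] Nc (inj₂ (~-sym c′~x)))

  -- c is the centre created by deleting xy; the centre created by deleting xc is then y (as wanted) or
  -- a neighbour of c ruled out by the shape of N(c).
  neighbourhood : ∀ {y} → x ~ y → ∃[ a ] ∃[ b ] ∃[ o ] Neighbourhood y a b o
  neighbourhood x~y =
    let c , d , D@(deletionClaw c~x c~y c~d _ d≁y) = deletion x~y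
        e , Nc = neighbourhood-from-leaf (~-sym c~x) x~y c~y c~d (≁-sym d≁y) (deletion-leaf-∉N[x] x~y D)
        c′ , d′ , D′@(deletionClaw _ c′~c _ _ _) = deletion (~-sym c~x)
    in neighbourhood-via-centre x~y Nc D′ (N.neighbours Nc (~-sym c′~c))

  no-triangle-at : ∀ {p a b o a₁ b₁ o₁ a₂ b₂ o₂} → Neighbourhood p a b o → Neighbourhood b a₁ b₁ o₁ →
                   Neighbourhood a a₂ b₂ o₂ → a ~ b → ⊥
  no-triangle-at {p} {a} {b} {o} {a₁} {b₁} {o₁} {a₂} {b₂} {o₂} Np Nb Na a~b =
    clash (common-neighbour Na (N.x~y Np) (~-sym (N.y~a Np))) (common-neighbour Na (N.x~b Np) a~b)
    where
    b₂~o₂ : b₂ ~ o₂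
    b₂~o₂ = ~-sym (N.o~b Na)
    o₂≢o : o₂ ≢ o
    o₂≢o o₂≡o = N.o≁a Np (~-sym (subst (a ~_) o₂≡o (N.y~o Na)))
    clash : p ≡ a₂ ⊎ p ≡ b₂ → b ≡ a₂ ⊎ b ≡ b₂ → ⊥
    clash (inj₁ p≡a₂) (inj₁ b≡a₂) = ~⇒≢ (N.y~b Np) (trans p≡a₂ (≡-sym b≡a₂))
    clash (inj₂ p≡b₂) _ = o₂≢o (private-neighbour Np (subst (_~ o₂) (≡-sym p≡b₂) b₂~o₂) (N.o∉N[x] Na))
    clash (inj₁ _) (inj₂ b≡b₂) =
      o₂≢o (trans (private-neighbour Nb (subst (_~ o₂) (≡-sym b≡b₂) b₂~o₂) (N.o∉N[x] Na))
                  (≡-sym (private-neighbour Nb (~-sym (N.o~b Np)) (N.o∉N[x] Np))))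

  no-triangle-through : ∀ {p q r a b o} → Neighbourhood p a b o → q ~ r → q ≡ a ⊎ q ≡ b → r ≡ a ⊎ r ≡ b → ⊥
  no-triangle-through Np q~r (inj₁ q≡a) (inj₁ r≡a) = ~⇒≢ q~r (trans q≡a (≡-sym r≡a))
  no-triangle-through Np q~r (inj₂ q≡b) (inj₂ r≡b) = ~⇒≢ q~r (trans q≡b (≡-sym r≡b))
  no-triangle-through Np q~r (inj₁ refl) (inj₂ refl) =
    let _ , _ , _ , Nq = neighbourhood (N.x~a Np)
        _ , _ , _ , Nr = neighbourhood (N.x~b Np)
    in no-triangle-at Np Nr Nq q~r
  no-triangle-through Np q~r (inj₂ refl) (inj₁ refl) =
    let _ , _ , _ , Nq = neighbourhood (N.x~b Np)
        _ , _ , _ , Nr = neighbourhood (N.x~a Np)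
    in no-triangle-at Np Nq Nr (~-sym q~r)

  no-triangle : (ws : Vec (Fin n) 3) → All (x ~_) (toList ws) → AllPairs _~_ (toList ws) → ⊥
  no-triangle (p ∷ q ∷ r ∷ []) (x~p ∷ x~q ∷ x~r ∷ []) ((p~q ∷ p~r ∷ []) ∷ (q~r ∷ []) ∷ [] ∷ []) =
    let _ , _ , _ , Np = neighbourhood x~p
    in no-triangle-through Np q~r (common-neighbour Np x~q p~q) (common-neighbour Np x~r p~r)

  impossible : ⊥
  impossible =
    let y , x~y , _ = fresh-neighbour [] (≤-trans (s≤s z≤n) (≤-reflexive (≡-sym deg-x)))
        a , b , _ , Ny = neighbourhood x~y
        ws , uws , hs = fresh-neighbours 3 (y ∷ a ∷ b ∷ []) (≤-reflexive (≡-sym deg-x))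
        common : ∀ {z} → x ~ z → y ~ z → z ∈ y ∷ a ∷ b ∷ []
        common x~z y~z = [ there ∘ here , there ∘ there ∘ here ]′ (common-neighbour Ny x~z y~z)
    in no-triangle ws (All.map proj₁ hs)
                   (clique-of-non-neighbours claw-free x~y uws (All.map (outside-common-neighbours (here refl) common) hs))

proposition4p9 : (n : ℕ) → n ≥ 7 → (G : Graph n) → ClawInducedSaturated G →
    ¬ (Σ (Fin n) λ v → degree G v ≡ 6 × (∀ w → w ≢ v → degree G w ≡ 4))
proposition4p9 n _ G (claw-free , saturated) (x , deg-x , deg-N) =
  DegreeSixVertex.impossible claw-free deletion x deg-x deg-N
  where
  deletion : ∀ {u v} → Adj G u v → ∃₂ (Claws.DeletionClaw G u v)
  deletion u~v = Claws.deletion-claw G claw-free u~v (saturated _ _ (Adjacency.~⇒≢ G u~v))
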